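{- Let $A_1,\dots,A_s$ be nonnegative integers. Then for any positive integers $k_1,\dots,k_s$ with $1\le k_i\le A_1+\cdots+A_s$ for all $i$, either $1\le k_i\le A_i$ for some $i$, or $-A_j\le k_i-k_j\le A_i-1$ for some $i<j$. -}

module Defs where

open import Data.Nat using (ℕ; zero; suc; _+_)
open import Data.Fin using (Fin; zero; suc)

∑ᶠ : {s : ℕ} → (Fin s → ℕ) → ℕ
∑ᶠ {zero} f = 0
∑ᶠ {suc s} f = f zero + ∑ᶠ (λ i → f (suc i))

{-# OPTIONS --safe #-}
-- If no k i ≤ A i, the half-open intervals [k i − A i, k i) lie in [1, ∑ A), which
-- has length ∑ A − 1, while their lengths add up to ∑ A.  If moreover
-- −A j ≤ k i − k j ≤ A i − 1 failed for all i < j, they would be pairwise disjoint,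
-- which is impossible: disjoint intervals inside [L, U) have total length at most
-- U − L, as one sees by removing the interval with the largest midpoint, which lies
-- to the right of all the others.
module Submission where

open import Defs
open import Data.Nat using (ℕ)
open import Data.Fin using (Fin; _<_)
open import Data.Product using (Σ; ∃; _×_)
open import Data.Sum using (_⊎_)
open import Data.Integer using (ℤ; +_; -_; _-_) renaming (_≤_ to _≤ℤ_)
import Data.Nat as N

open import Data.Nat using (zero; suc; _+_; _∸_; _≤_; _≤?_; _<?_)
open import Data.Nat.Properties
  using ( +-comm; +-assoc; ≤-trans; +-monoʳ-≤; +-cancelˡ-≤; +-cancelʳ-≤
        ; ≰⇒>; ≮⇒≥; <⇒≤; <-irrefl; m≤m+n; m<n⇒0<n∸m; m∸n+n≡m; +-0-commutativeMonoid
        ; module ≤-Reasoning)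
open import Data.Integer using (_⊖_)
import Data.Integer.Properties as ℤ
open import Data.Fin using (zero; suc; punchIn)
open import Data.Fin.Properties using (punchIn-injective; punchInᵢ≢i; any?; <-cmp)
import Data.Fin.Properties as Fin
open import Data.Vec.Functional using (Vector; removeAt)
open import Algebra.Properties.CommutativeMonoid.Sum +-0-commutativeMonoid using (sum; sum-remove)
open import Data.List using (allFin)
open import Data.List.Relation.Unary.All as All using ()
open import Data.List.Extrema.Nat using (argmax; f[xs]≤f[argmax])
open import Data.List.Membership.Propositional.Properties using (∈-allFin)
open import Data.Product using (_,_; proj₁; proj₂)
open import Data.Sum using (inj₁; inj₂; swap; fromInj₂)
import Data.Sum as Sum
open import Data.Empty using (⊥-elim)
open import Relation.Nullary using (Dec; yes; no)
open import Relation.Nullary.Decidable using (_×-dec_)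
open import Relation.Binary using (tri<; tri≈; tri>)
open import Function using (_∘_)
open import Relation.Binary.PropositionalEquality
  using (_≡_; _≢_; refl; sym; cong; subst; subst₂; module ≡-Reasoning)

∑ᶠ≡sum : ∀ {s} (f : Vector ℕ s) → ∑ᶠ f ≡ sum f
∑ᶠ≡sum {zero} f = refl
∑ᶠ≡sum {suc s} f = cong (f zero N.+_) (∑ᶠ≡sum (λ i → f (suc i)))

∑ᶠ-remove : ∀ {s} (f : Vector ℕ (suc s)) i → ∑ᶠ f ≡ f i + ∑ᶠ (removeAt f i)
∑ᶠ-remove f i = begin
  ∑ᶠ f                    ≡⟨ ∑ᶠ≡sum f ⟩
  sum f                   ≡⟨ sum-remove f ⟩
  f i + sum (removeAt f i) ≡⟨ cong (f i N.+_) (∑ᶠ≡sum (removeAt f i)) ⟨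
  f i + ∑ᶠ (removeAt f i) ∎
  where open ≡-Reasoning

argmaxᶠ : ∀ {s} (g : Fin (suc s) → ℕ) → ∃ λ m → ∀ i → g i ≤ g m
argmaxᶠ {s} g = m , λ i → All.lookup (f[xs]≤f[argmax] {f = g} zero (allFin (suc s))) (∈-allFin i)
  where m = argmax g zero (allFin (suc s))

-- (a, A) encodes the interval [a, a + A).
Apart : (a A b B : ℕ) → Set
Apart a A b B = a + A ≤ b ⊎ b + B ≤ a

-- a + (a + A) is twice the midpoint of [a, a + A).  Comparing right endpoints
-- instead fails for empty intervals, which may sit at the right end of another.
apart-by-midpoint : ∀ {a A b B} → Apart a A b B → a + (a + A) ≤ b + (b + B) → a + A ≤ b
apart-by-midpoint (inj₁ a+A≤b) _ = a+A≤b
apart-by-midpoint {a} {A} {b} {B} (inj₂ b+B≤a) mid = +-cancelˡ-≤ a _ _ (begin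
  a + (a + A) ≤⟨ mid ⟩
  b + (b + B) ≤⟨ +-monoʳ-≤ b b+B≤a ⟩
  b + a       ≡⟨ +-comm b a ⟩
  a + b       ∎)
  where open ≤-Reasoning

apart-intervals-∑ᶠ≤ : ∀ {s L U} (a A : Fin s → ℕ) → L ≤ U →
                      (∀ i → L ≤ a i × a i + A i ≤ U) →
                      (∀ i j → i ≢ j → Apart (a i) (A i) (a j) (A j)) →
                      ∑ᶠ A + L ≤ U
apart-intervals-∑ᶠ≤ {zero} a A L≤U _ _ = L≤U
apart-intervals-∑ᶠ≤ {suc s} {L} {U} a A _ inside apart = begin
  ∑ᶠ A + L                       ≡⟨ cong (N._+ L) (∑ᶠ-remove A m) ⟩
  A m + ∑ᶠ (removeAt A m) + L    ≡⟨ +-assoc (A m) _ L ⟩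
  A m + (∑ᶠ (removeAt A m) + L)  ≤⟨ +-monoʳ-≤ (A m) others-fit ⟩
  A m + a m                      ≡⟨ +-comm (A m) (a m) ⟩
  a m + A m                      ≤⟨ proj₂ (inside m) ⟩
  U                              ∎
  where
  open ≤-Reasoning
  rightmost : ∃ λ m → ∀ i → a i + (a i + A i) ≤ a m + (a m + A m)
  rightmost = argmaxᶠ (λ i → a i + (a i + A i))

  m : Fin (suc s)
  m = proj₁ rightmost

  left-of-m : ∀ i → i ≢ m → a i + A i ≤ a m
  left-of-m i i≢m = apart-by-midpoint (apart i m i≢m) (proj₂ rightmost i)

  others-fit : ∑ᶠ (removeAt A m) + L ≤ a m
  others-fit = apart-intervals-∑ᶠ≤ (removeAt a m) (removeAt A m) (proj₁ (inside m))
    (λ i → proj₁ (inside (punchIn m i)) , left-of-m (punchIn m i) (punchInᵢ≢i m i))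
    (λ i j i≢j → apart (punchIn m i) (punchIn m j) (i≢j ∘ punchIn-injective m i j))

apart-right-endpoints-∑ᶠ< : ∀ {s U} (A k : Fin (suc s) → ℕ) →
                            (∀ i → A i N.< k i × k i ≤ U) →
                            (∀ i j → i < j → k i + A j ≤ k j ⊎ k j + A i ≤ k i) →
                            ∑ᶠ A N.< U
apart-right-endpoints-∑ᶠ< {s} {U} A k k-range k-apart =
  subst (_≤ U) (+-comm (∑ᶠ A) 1) (apart-intervals-∑ᶠ≤ a A 1≤U inside apart)
  where
  a : Fin (suc s) → ℕ
  a i = k i ∸ A i

  k≡a+A : ∀ i → k i ≡ a i + A i
  k≡a+A i = sym (m∸n+n≡m (<⇒≤ (proj₁ (k-range i))))

  inside : ∀ i → 1 ≤ a i × a i + A i ≤ U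
  inside i = m<n⇒0<n∸m (proj₁ (k-range i)) , subst (_≤ U) (k≡a+A i) (proj₂ (k-range i))

  1≤U : 1 ≤ U
  1≤U = ≤-trans (proj₁ (inside zero)) (≤-trans (m≤m+n _ _) (proj₂ (inside zero)))

  left-endpoint : ∀ i j → k i + A j ≤ k j → a i + A i ≤ a j
  left-endpoint i j = +-cancelʳ-≤ (A j) _ _ ∘ subst₂ (λ u v → u + A j ≤ v) (k≡a+A i) (k≡a+A j)

  apart : ∀ i j → i ≢ j → Apart (a i) (A i) (a j) (A j)
  apart i j i≢j with <-cmp i j
  ... | tri< i<j _ _ = Sum.map (left-endpoint i j) (left-endpoint j i) (k-apart i j i<j)
  ... | tri≈ _ i≡j _ = ⊥-elim (i≢j i≡j)
  ... | tri> _ _ j<i = Sum.map (left-endpoint i j) (left-endpoint j i) (swap (k-apart j i j<i))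

m+q≤n+p⇒m-n≤p-q : ∀ m n p q → m + q ≤ n + p → + m - + n ≤ℤ + p - + q
m+q≤n+p⇒m-n≤p-q m n p q m+q≤n+p = begin
  + m - + n          ≡⟨ ℤ.m-n≡m⊖n m n ⟩
  m ⊖ n              ≡⟨ ℤ.+-cancelˡ-⊖ q m n ⟨
  (q + m) ⊖ (q + n)  ≤⟨ ℤ.⊖-monoˡ-≤ (q + n) (subst (_≤ n + p) (+-comm m q) m+q≤n+p) ⟩
  (n + p) ⊖ (q + n)  ≡⟨ cong ((n + p) ⊖_) (+-comm q n) ⟩
  (n + p) ⊖ (n + q)  ≡⟨ ℤ.+-cancelˡ-⊖ n p q ⟩
  p ⊖ q              ≡⟨ ℤ.m-n≡m⊖n p q ⟨
  + p - + q          ∎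
  where open ℤ.≤-Reasoning

-- For right endpoints x, y of [x − a, x) and [y − b, y).  Not symmetric: the first
-- ending exactly where the second starts also counts.
Overlap : (x a y b : ℕ) → Set
Overlap x a y b = - (+ b) ≤ℤ + x - + y × + x - + y ≤ℤ + a - + 1

overlap? : ∀ x a y b → Dec (Overlap x a y b)
overlap? x a y b = (- (+ b) ℤ.≤? + x - + y) ×-dec (+ x - + y ℤ.≤? + a - + 1)

overlap-or-apart : ∀ x a y b → Overlap x a y b ⊎ (x + b ≤ y ⊎ y + a ≤ x)
overlap-or-apart x a y b with y ≤? b + x | x <? y + a
... | no y≰b+x    | _           = inj₂ (inj₁ (subst (_≤ y) (+-comm b x) (<⇒≤ (≰⇒> y≰b+x))))
... | yes _       | no x≮y+a    = inj₂ (inj₂ (≮⇒≥ x≮y+a))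
... | yes y≤b+x   | yes x<y+a   = inj₁ (lower , upper)
  where
  lower : - (+ b) ≤ℤ + x - + y
  lower = subst (_≤ℤ + x - + y) (ℤ.+-identityˡ (- (+ b))) (m+q≤n+p⇒m-n≤p-q 0 b x y y≤b+x)
  upper : + x - + y ≤ℤ + a - + 1
  upper = m+q≤n+p⇒m-n≤p-q x y a 1 (subst (_≤ y + a) (+-comm 1 x) x<y+a)

lemma4p2 : (s : ℕ) → 1 N.≤ s → (A : Fin s → ℕ) (k : Fin s → ℕ) →
           (∀ i → 1 N.≤ k i × k i N.≤ ∑ᶠ A) →
           (∃ λ i → 1 N.≤ k i × k i N.≤ A i)
           ⊎ (∃ λ i → ∃ λ j → i < j × (- (+ A j) ≤ℤ (+ k i) - (+ k j)) × ((+ k i) - (+ k j) ≤ℤ (+ A i) - (+ 1)))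
lemma4p2 (suc s) _ A k k-range with any? (λ i → k i ≤? A i)
... | yes (i , kᵢ≤Aᵢ) = inj₁ (i , proj₁ (k-range i) , kᵢ≤Aᵢ)
... | no no-short with any? (λ i → any? (λ j → (i Fin.<? j) ×-dec overlap? (k i) (A i) (k j) (A j)))
... | yes overlapping-pair = inj₂ overlapping-pair
... | no no-overlap = ⊥-elim (<-irrefl refl (apart-right-endpoints-∑ᶠ< A k long apart))
  where
  long : ∀ i → A i N.< k i × k i ≤ ∑ᶠ A
  long i = ≰⇒> (no-short ∘ (i ,_)) , proj₂ (k-range i)

  apart : ∀ i j → i < j → k i + A j ≤ k j ⊎ k j + A i ≤ k i
  apart i j i<j = fromInj₂ (λ meet → ⊥-elim (no-overlap (i , j , i<j , meet)))
                           (overlap-or-apart (k i) (A i) (k j) (A j))
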